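{- Let $N\ge 2$. There exists a constant $\alpha_N>0$ depending only on $N$ such that for every $N$-cycle $\tau\in S_N$, $$\#\left\{ \Gamma \in \mathcal{C}_N(\tau) : \lambda_N(\Gamma) \leq R,\ \Gamma \text{ is } \mathrm{WR}' \right\} \geq \alpha_N R^N$$ as $R\to\infty$; moreover the same $\alpha_N$ works for $\tau=(1\ 2\ \cdots\ N)$, i.e. for the set of all full-rank sublattices $\Gamma\subseteq\mathbb{Z}^N$ with $\operatorname{rot}(\Gamma)=\Gamma$, where $\operatorname{rot}(x_1,\dots,x_N)=(x_N,x_1,\dots,x_{N-1})$.
   Context: $S_N$ acts on $\mathbb{R}^N$ by $\tau x=(x_{\tau(1)},\dots,x_{\tau(N)})^t$. A lattice $\Lambda\subset\mathbb{R}^N$ is $\tau$-invariant if $\tau\Lambda=\Lambda$. $\mathcal{C}_N(\tau)$ is the set of all $\tau$-invariant full-rank sublattices of $\mathbb{Z}^N$. $\lambda_N(\Gamma)$ is the $N$-th successive minimum of $\Gamma$ with respect to the Euclidean norm; $S(\Gamma)$ is the set of vectors of $\Gamma$ of minimal nonzero Euclidean norm, and $\Gamma$ is $\mathrm{WR}'$ if $\Gamma=\operatorname{span}_{\mathbb{Z}}S(\Gamma)$.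
   Formalization: The radius R ranges over the rationals instead of the positive reals, and the constant $\alpha_N$ and the threshold beyond which the lower bound holds are taken in ℚ. -}

module Defs where

open import Level using (0ℓ)
open import Data.Nat as ℕ using (ℕ; zero; suc)
open import Data.Integer as ℤ using (ℤ; +_)
open import Data.Rational as ℚ using (ℚ)
open import Data.Fin using (Fin; zero; suc; fromℕ; inject₁)
open import Data.Fin.Permutation using (Permutation′; _⟨$⟩ʳ_)
open import Data.Product using (Σ; ∃; _×_; _,_)
open import Relation.Binary.PropositionalEquality using (_≡_; _≢_)
open import Relation.Nullary using (¬_)

Vecℤ : ℕ → Set
Vecℤ N = Fin N → ℤ

Σᶠ : ∀ {k} → (Fin k → ℤ) → ℤ
Σᶠ {zero}  f = + 0
Σᶠ {suc k} f = f zero ℤ.+ Σᶠ (λ i → f (suc i))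

IsZero : ∀ {N} → Vecℤ N → Set
IsZero v = ∀ j → v j ≡ + 0

‖_‖² : ∀ {N} → Vecℤ N → ℤ
‖ v ‖² = Σᶠ (λ j → v j ℤ.* v j)

lincomb : ∀ {k N} → (Fin k → ℤ) → (Fin k → Vecℤ N) → Vecℤ N
lincomb c b j = Σᶠ (λ i → c i ℤ.* b i j)

InSpan : ∀ {k N} → (Fin k → Vecℤ N) → Vecℤ N → Set
InSpan b x = ∃ λ c → ∀ j → x j ≡ lincomb c b j

-- linear independence (over ℤ; equivalent to ℝ-independence for integer vectors)
LinIndep : ∀ {k N} → (Fin k → Vecℤ N) → Set
LinIndep b = ∀ c → IsZero (lincomb c b) → ∀ i → c i ≡ + 0

Subset : ℕ → Set₁
Subset N = Vecℤ N → Set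

_≐_ : ∀ {N} → Subset N → Subset N → Set
A ≐ B = ∀ x → (A x → B x) × (B x → A x)

FullRankSublattice : ∀ {N} → Subset N → Set
FullRankSublattice {N} Γ = Σ (Fin N → Vecℤ N) λ b → LinIndep b × (Γ ≐ InSpan b)

act : ∀ {N} → Permutation′ N → Vecℤ N → Vecℤ N
act τ x i = x (τ ⟨$⟩ʳ i)

image : ∀ {N} → (Vecℤ N → Vecℤ N) → Subset N → Subset N
image f Γ y = ∃ λ x → Γ x × (∀ j → y j ≡ f x j)

InC : ∀ {N} → Permutation′ N → Subset N → Set
InC τ Γ = FullRankSublattice Γ × (image (act τ) Γ ≐ Γ)

iter : ∀ {N} → Permutation′ N → ℕ → Fin N → Fin N
iter τ zero    i = i
iter τ (suc k) i = τ ⟨$⟩ʳ (iter τ k i)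

IsNCycle : ∀ {N} → Permutation′ N → Set
IsNCycle {N} τ = ∀ i j → ∃ λ k → iter τ k i ≡ j

rot : ∀ {n} → Vecℤ (suc n) → Vecℤ (suc n)
rot {n} x zero    = x (fromℕ n)
rot {n} x (suc i) = x (inject₁ i)

InS : ∀ {N} → Subset N → Subset N
InS Γ v = Γ v × ¬ IsZero v × (∀ w → Γ w → ¬ IsZero w → ‖ v ‖² ℤ.≤ ‖ w ‖²)

SpanS : ∀ {N} → Subset N → Subset N
SpanS Γ x = ∃ λ k → Σ (Fin k → Vecℤ _) λ vs → (∀ i → InS Γ (vs i)) × InSpan vs x

WR′ : ∀ {N} → Subset N → Set
WR′ Γ = Γ ≐ SpanS Γ

ℤ→ℚ : ℤ → ℚ
ℤ→ℚ z = z ℚ./ 1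

ℕ→ℚ : ℕ → ℚ
ℕ→ℚ n = ℤ→ℚ (+ n)

_^ℚ_ : ℚ → ℕ → ℚ
q ^ℚ zero  = ℚ.1ℚ
q ^ℚ suc n = q ℚ.* (q ^ℚ n)

-- λ_N(Γ) ≤ R (for R ≥ 0): Γ contains N linearly independent vectors of norm ≤ R
-- (the infimum defining λ_N is attained); norm ≤ R is expressed as ‖v‖² ≤ R².
λN≤ : ∀ {N} → Subset N → ℚ → Set
λN≤ {N} Γ R = Σ (Fin N → Vecℤ N) λ b →
  LinIndep b × (∀ i → Γ (b i)) × (∀ i → ℤ→ℚ ‖ b i ‖² ℚ.≤ R ℚ.* R)

-- "#{Γ : P Γ} ≥ k": there are k pairwise distinct subsets satisfying P
AtLeast : ∀ {N} → (Subset N → Set) → ℕ → Set₁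
AtLeast {N} P k = Σ (Fin k → Subset N) λ L →
  (∀ i → P (L i)) × (∀ i j → i ≢ j → ¬ (L i ≐ L j))

-- #{Γ ∈ C : λ_N(Γ) ≤ R, Γ WR'} ≥ α R^N for all R ≥ R₀
EventualLowerBound : ∀ {N} → (Subset N → Set) → ℚ → Set₁
EventualLowerBound {N} C α = ∃ λ (R₀ : ℚ) → ∀ (R : ℚ) → R₀ ℚ.≤ R → ℚ.0ℚ ℚ.≤ R →
  ∃ λ (k : ℕ) → (α ℚ.* (R ^ℚ N) ℚ.≤ ℕ→ℚ k) ×
    AtLeast (λ Γ → C Γ × λN≤ Γ R × WR′ Γ) k

-- Let τ be an N-cycle. For K ≥ 1 and u ∈ {0,…,K−1}ᴺ put v = (M + u₀, u₁, …, u_{N−1}) with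
-- M = 8NK, and let Γ_u be spanned by the translates v, τv, …, τᴺ⁻¹v; it is τ-invariant because τ
-- permutes the translates cyclically. Each translate carries the large entry M + u₀ at a coordinate
-- of its own and entries below K elsewhere, so reading a combination Σ cᵢ τⁱv at these coordinates
-- shows that it is 0, ±τⁱv, or has squared norm at least 2(7NK)² > ‖v‖². Hence the translates are
-- independent and are minimal vectors, Γ_u is WR′ with λ_N(Γ_u) ≤ ‖v‖ ≤ 9NK, and u is recovered from
-- Γ_u as its minimal vector with the large entry at coordinate 0. For R ≥ 9N take K = ⌊⌊R⌋/9N⌋:
-- the Kᴺ lattices Γ_u number at least (18N)⁻ᴺ Rᴺ. The rotation is the N-cycle 0 ↦ N−1, i+1 ↦ i.

module Submission where

open import Defs
open import Data.Nat as ℕ using (ℕ; zero; suc; _+_; _*_; _∸_; _^_; _≤_; z≤n; s≤s)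
open import Data.Nat.Properties as ℕP using (≤-refl; ≤-trans; ≤-reflexive)
open import Data.Integer as ℤ using (ℤ; +_; -[1+_]; ∣_∣)
open import Data.Integer.Properties as ℤP using ()
open import Data.Fin as Fin using (Fin; zero; suc; toℕ; fromℕ; inject₁)
open import Data.Fin.Properties as FinP using ()
open import Data.Product using (∃; _×_; _,_; proj₁; proj₂)
open import Data.Empty using (⊥-elim)
open import Function using (_∘_)
open import Data.Fin.Permutation using (Permutation′; _⟨$⟩ʳ_; _⟨$⟩ˡ_; inverseˡ; insert; id)
open import Data.Nat.DivMod
  using (_%_; _/_; m≡m%n+[m/n]*n; m%n<n; m/n*n≤m; m*n/n≡m; /-monoˡ-≤; m≥n⇒m/n>0)
open import Relation.Binary.Definitions using (tri<; tri≈; tri>)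
open import Relation.Binary.PropositionalEquality
open import Relation.Nullary using (¬_; yes; no)
open import Relation.Nullary.Decidable using (_⊎-dec_)
open import Data.Sum using (inj₁; inj₂; fromInj₂)
import Algebra.Properties.Semiring.Sum as SemiringSum
open import Data.Rational as ℚ using (ℚ; mkℚ; 0ℚ; 1ℚ; _<_)
open import Data.Rational.Properties as ℚP using ()
import Data.Nat.Coprimality as Coprime
open import Data.Integer.Tactic.RingSolver using (solve-∀)
import Data.Nat.Tactic.RingSolver as ℕSolver

module ℤΣ = SemiringSum ℤP.+-*-semiring
module ℕΣ = SemiringSum ℕP.+-*-semiring


Σᶠ≡sum : ∀ {k} (f : Fin k → ℤ) → Σᶠ f ≡ ℤΣ.sum f
Σᶠ≡sum {zero}  f = refl
Σᶠ≡sum {suc k} f = cong (ℤ._+_ (f zero)) (Σᶠ≡sum (f ∘ suc))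

Σᶠ-cong : ∀ {k} {f g : Fin k → ℤ} → (∀ i → f i ≡ g i) → Σᶠ f ≡ Σᶠ g
Σᶠ-cong {zero}  f≗g = refl
Σᶠ-cong {suc k} f≗g = cong₂ ℤ._+_ (f≗g zero) (Σᶠ-cong (f≗g ∘ suc))

Σᶠ-zero : ∀ k → Σᶠ {k} (λ _ → + 0) ≡ + 0
Σᶠ-zero zero    = refl
Σᶠ-zero (suc k) = cong (ℤ._+_ (+ 0)) (Σᶠ-zero k)

Σᶠ-single : ∀ {k} (f : Fin k → ℤ) i → (∀ j → j ≢ i → f j ≡ + 0) → Σᶠ f ≡ f i
Σᶠ-single {suc k} f zero    f≡0 = begin
  f zero ℤ.+ Σᶠ (f ∘ suc)      ≡⟨ cong (ℤ._+_ (f zero)) (Σᶠ-cong (λ j → f≡0 (suc j) λ ())) ⟩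
  f zero ℤ.+ Σᶠ {k} (λ _ → + 0) ≡⟨ cong (ℤ._+_ (f zero)) (Σᶠ-zero k) ⟩
  f zero ℤ.+ + 0               ≡⟨ ℤP.+-identityʳ (f zero) ⟩
  f zero                       ∎
  where open ≡-Reasoning
Σᶠ-single {suc k} f (suc i) f≡0 = begin
  f zero ℤ.+ Σᶠ (f ∘ suc)
    ≡⟨ cong₂ ℤ._+_ (f≡0 zero λ ()) (Σᶠ-single (f ∘ suc) i λ j → f≡0 (suc j) ∘ (_∘ FinP.suc-injective)) ⟩
  + 0 ℤ.+ f (suc i)            ≡⟨ ℤP.+-identityˡ (f (suc i)) ⟩
  f (suc i)                    ∎
  where open ≡-Reasoning

f≤sum : ∀ {k} (f : Fin k → ℕ) i → f i ≤ ℕΣ.sum f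
f≤sum f zero    = ℕP.m≤m+n (f zero) _
f≤sum f (suc i) = ≤-trans (f≤sum (f ∘ suc) i) (ℕP.m≤n+m _ (f zero))

f+f≤sum : ∀ {k} (f : Fin k → ℕ) {i j} → i ≢ j → f i + f j ≤ ℕΣ.sum f
f+f≤sum f {zero}  {zero}  i≢j = ⊥-elim (i≢j refl)
f+f≤sum f {zero}  {suc j} i≢j = ℕP.+-monoʳ-≤ (f zero) (f≤sum (f ∘ suc) j)
f+f≤sum f {suc i} {zero}  i≢j = ≤-trans (≤-reflexive (ℕP.+-comm (f (suc i)) (f zero)))
                                        (ℕP.+-monoʳ-≤ (f zero) (f≤sum (f ∘ suc) i))
f+f≤sum f {suc i} {suc j} i≢j = ≤-trans (f+f≤sum (f ∘ suc) (i≢j ∘ cong suc)) (ℕP.m≤n+m _ (f zero))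

sum≤* : ∀ {k} (f : Fin k → ℕ) {c} → (∀ i → f i ≤ c) → ℕΣ.sum f ≤ k * c
sum≤* {zero}  f f≤c = z≤n
sum≤* {suc k} f f≤c = ℕP.+-mono-≤ (f≤c zero) (sum≤* (f ∘ suc) (f≤c ∘ suc))

∣sum∣≤sum∣∣ : ∀ {k} (f : Fin k → ℤ) → ∣ ℤΣ.sum f ∣ ≤ ℕΣ.sum (∣_∣ ∘ f)
∣sum∣≤sum∣∣ {zero}  f = z≤n
∣sum∣≤sum∣∣ {suc k} f =
  ≤-trans (ℤP.∣i+j∣≤∣i∣+∣j∣ (f zero) _) (ℕP.+-monoʳ-≤ ∣ f zero ∣ (∣sum∣≤sum∣∣ (f ∘ suc)))

∣i∣≤∣i+j∣+∣j∣ : ∀ i j → ∣ i ∣ ≤ ∣ i ℤ.+ j ∣ + ∣ j ∣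
∣i∣≤∣i+j∣+∣j∣ i j = begin
  ∣ i ∣                   ≡⟨ cong ∣_∣ (i≡[i+j]-j i j) ⟨
  ∣ i ℤ.+ j ℤ.- j ∣       ≤⟨ ℤP.∣i-j∣≤∣i∣+∣j∣ (i ℤ.+ j) j ⟩
  ∣ i ℤ.+ j ∣ + ∣ j ∣     ∎
  where
  open ℕP.≤-Reasoning
  i≡[i+j]-j : ∀ i j → i ℤ.+ j ℤ.- j ≡ i
  i≡[i+j]-j = solve-∀

dominant-term : ∀ {n} (f : Fin (suc n) → ℤ) i {B} → (∀ j → j ≢ i → ∣ f j ∣ ≤ B) →
                ∣ f i ∣ ≤ ∣ Σᶠ f ∣ + n * B
dominant-term {n} f i {B} small = begin
  ∣ f i ∣                      ≤⟨ ∣i∣≤∣i+j∣+∣j∣ (f i) rest ⟩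
  ∣ f i ℤ.+ rest ∣ + ∣ rest ∣  ≡⟨ cong (λ s → ∣ s ∣ + ∣ rest ∣) (trans (Σᶠ≡sum f) (ℤΣ.sum-remove f)) ⟨
  ∣ Σᶠ f ∣ + ∣ rest ∣          ≤⟨ ℕP.+-monoʳ-≤ ∣ Σᶠ f ∣ (∣sum∣≤sum∣∣ (f ∘ Fin.punchIn i)) ⟩
  ∣ Σᶠ f ∣ + ℕΣ.sum (∣_∣ ∘ f ∘ Fin.punchIn i)
                               ≤⟨ ℕP.+-monoʳ-≤ ∣ Σᶠ f ∣ (sum≤* _ λ j → small _ (FinP.punchInᵢ≢i i j)) ⟩
  ∣ Σᶠ f ∣ + n * B             ∎
  where
  open ℕP.≤-Reasoning
  rest = ℤΣ.sum (f ∘ Fin.punchIn i)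

normℕ : ∀ {N} → Vecℤ N → ℕ
normℕ v = ℕΣ.sum (λ j → ∣ v j ∣ * ∣ v j ∣)

‖‖²≡normℕ : ∀ {N} (v : Vecℤ N) → ‖ v ‖² ≡ + normℕ v
‖‖²≡normℕ {zero}  v = refl
‖‖²≡normℕ {suc N} v = cong₂ ℤ._+_ (i*i≡∣i∣*∣i∣ (v zero)) (‖‖²≡normℕ (v ∘ suc))
  where
  i*i≡∣i∣*∣i∣ : ∀ i → i ℤ.* i ≡ + (∣ i ∣ * ∣ i ∣)
  i*i≡∣i∣*∣i∣ (+ m)    = sym (ℤP.pos-* m m)
  i*i≡∣i∣*∣i∣ -[1+ m ] = ℤP.+◃n≡+n _

normℕ-cong : ∀ {N} {v w : Vecℤ N} → (∀ j → v j ≡ w j) → normℕ v ≡ normℕ w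
normℕ-cong v≗w = ℕΣ.sum-cong-≗ (λ j → cong (λ z → ∣ z ∣ * ∣ z ∣) (v≗w j))

normℕ-zero : ∀ {N} {v : Vecℤ N} → IsZero v → normℕ v ≡ 0
normℕ-zero {N} v≡0 = trans (normℕ-cong v≡0) (ℕΣ.sum-replicate-zero N)

∣v∣²≤normℕ : ∀ {N} (v : Vecℤ N) j → ∣ v j ∣ * ∣ v j ∣ ≤ normℕ v
∣v∣²≤normℕ v = f≤sum (λ j → ∣ v j ∣ * ∣ v j ∣)

normℕ-neg : ∀ {N} (v : Vecℤ N) → normℕ (ℤ.-_ ∘ v) ≡ normℕ v
normℕ-neg v = ℕΣ.sum-cong-≗ (λ j → cong (λ z → z * z) (ℤP.∣-i∣≡∣i∣ (v j)))

2a²≤normℕ : ∀ {N} (v : Vecℤ N) {a} q → a * 2 ≤ ∣ v q ∣ → 2 * (a * a) ≤ normℕ v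
2a²≤normℕ v {a} q 2a≤∣vq∣ = begin
  2 * (a * a)                ≤⟨ ℕP.m≤m+n (2 * (a * a)) (2 * (a * a)) ⟩
  2 * (a * a) + 2 * (a * a)  ≡⟨ square a ⟩
  (a * 2) * (a * 2)          ≤⟨ ℕP.*-mono-≤ 2a≤∣vq∣ 2a≤∣vq∣ ⟩
  ∣ v q ∣ * ∣ v q ∣          ≤⟨ ∣v∣²≤normℕ v q ⟩
  normℕ v                    ∎
  where
  open ℕP.≤-Reasoning
  square : ∀ a → 2 * (a * a) + 2 * (a * a) ≡ (a * 2) * (a * 2)
  square = ℕSolver.solve-∀

2a²≤normℕ′ : ∀ {N} (v : Vecℤ N) {a q q′} → q ≢ q′ → a ≤ ∣ v q ∣ → a ≤ ∣ v q′ ∣ → 2 * (a * a) ≤ normℕ v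
2a²≤normℕ′ v {a} {q} {q′} q≢q′ a≤∣vq∣ a≤∣vq′∣ = begin
  2 * (a * a)                          ≡⟨ cong (_+_ (a * a)) (ℕP.+-identityʳ (a * a)) ⟩
  a * a + a * a
    ≤⟨ ℕP.+-mono-≤ (ℕP.*-mono-≤ a≤∣vq∣ a≤∣vq∣) (ℕP.*-mono-≤ a≤∣vq′∣ a≤∣vq′∣) ⟩
  ∣ v q ∣ * ∣ v q ∣ + ∣ v q′ ∣ * ∣ v q′ ∣  ≤⟨ f+f≤sum (λ j → ∣ v j ∣ * ∣ v j ∣) q≢q′ ⟩
  normℕ v                              ∎
  where open ℕP.≤-Reasoning

normℕ-act : ∀ {N} (τ : Permutation′ N) (v : Vecℤ N) → normℕ (act τ v) ≡ normℕ v
normℕ-act τ v = sym (ℕΣ.∑-permute (λ j → ∣ v j ∣ * ∣ v j ∣) τ)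

lincomb-zero : ∀ {k N} {c : Fin k → ℤ} (b : Fin k → Vecℤ N) → (∀ i → c i ≡ + 0) → IsZero (lincomb c b)
lincomb-zero {k} b c≡0 j =
  trans (Σᶠ-cong (λ i → trans (cong (ℤ._* b i j) (c≡0 i)) (ℤP.*-zeroˡ (b i j)))) (Σᶠ-zero k)

lincomb-permute : ∀ {N} (π : Permutation′ N) (c : Fin N → ℤ) (b : Fin N → Vecℤ N) j →
                  lincomb c b j ≡ lincomb (c ∘ (π ⟨$⟩ʳ_)) (b ∘ (π ⟨$⟩ʳ_)) j
lincomb-permute π c b j = begin
  Σᶠ term                           ≡⟨ Σᶠ≡sum term ⟩
  ℤΣ.sum term                       ≡⟨ ℤΣ.∑-permute term π ⟩
  ℤΣ.sum (term ∘ (π ⟨$⟩ʳ_))         ≡⟨ Σᶠ≡sum (term ∘ (π ⟨$⟩ʳ_)) ⟨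
  Σᶠ (term ∘ (π ⟨$⟩ʳ_))             ∎
  where
  open ≡-Reasoning
  term : Fin _ → ℤ
  term i = c i ℤ.* b i j

lincomb-single : ∀ {k N} {c : Fin k → ℤ} (b : Fin k → Vecℤ N) {i} → (∀ l → l ≢ i → c l ≡ + 0) →
                 ∀ j → lincomb c b j ≡ c i ℤ.* b i j
lincomb-single {c = c} b {i} others j =
  Σᶠ-single (λ l → c l ℤ.* b l j) i
    λ l l≢i → trans (cong (ℤ._* b l j) (others l l≢i)) (ℤP.*-zeroˡ (b l j))

InSpan-resp : ∀ {k N} {b : Fin k → Vecℤ N} {x y : Vecℤ N} → (∀ j → x j ≡ y j) → InSpan b x → InSpan b y
InSpan-resp x≗y (c , x≡) = c , λ j → trans (sym (x≗y j)) (x≡ j)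

InSpan-lincomb : ∀ {k m N} {b : Fin k → Vecℤ N} (d : Fin m → ℤ) {vs : Fin m → Vecℤ N} →
                 (∀ i → InSpan b (vs i)) → InSpan b (lincomb d vs)
InSpan-lincomb {b = b} d {vs} vs∈ = coeff , λ j → begin
  Σᶠ (λ i → d i ℤ.* vs i j)
    ≡⟨ Σᶠ-cong (λ i → cong (d i ℤ.*_) (trans (proj₂ (vs∈ i) j) (Σᶠ≡sum (vsᵢ j i)))) ⟩
  Σᶠ (λ i → d i ℤ.* ℤΣ.sum (vsᵢ j i))
    ≡⟨ Σᶠ≡sum (λ i → d i ℤ.* ℤΣ.sum (vsᵢ j i)) ⟩
  ℤΣ.sum (λ i → d i ℤ.* ℤΣ.sum (vsᵢ j i))
    ≡⟨ ℤΣ.sum-cong-≗ (λ i → ℤΣ.*-distribˡ-sum (d i) (vsᵢ j i)) ⟩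
  ℤΣ.sum (λ i → ℤΣ.sum (λ l → d i ℤ.* (e i l ℤ.* b l j)))
    ≡⟨ ℤΣ.∑-comm (λ i l → d i ℤ.* (e i l ℤ.* b l j)) ⟩
  ℤΣ.sum (λ l → ℤΣ.sum (λ i → d i ℤ.* (e i l ℤ.* b l j)))
    ≡⟨ ℤΣ.sum-cong-≗ (λ l → regroup l) ⟩
  ℤΣ.sum (λ l → coeff l ℤ.* b l j)
    ≡⟨ Σᶠ≡sum (λ l → coeff l ℤ.* b l j) ⟨
  Σᶠ (λ l → coeff l ℤ.* b l j)
    ∎
  where
  open ≡-Reasoning
  e : _ → _ → ℤ
  e i = proj₁ (vs∈ i)
  vsᵢ : _ → _ → _ → ℤ
  vsᵢ j i l = e i l ℤ.* b l j
  coeff : _ → ℤ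
  coeff l = ℤΣ.sum (λ i → d i ℤ.* e i l)
  regroup : ∀ l {j} → ℤΣ.sum (λ i → d i ℤ.* (e i l ℤ.* b l j)) ≡ coeff l ℤ.* b l j
  regroup l {j} = trans (ℤΣ.sum-cong-≗ (λ i → sym (ℤP.*-assoc (d i) (e i l) (b l j))))
                        (sym (ℤΣ.*-distribʳ-sum (b l j) (λ i → d i ℤ.* e i l)))

InSpan-member : ∀ {k N} (b : Fin k → Vecℤ N) i → InSpan b (b i)
InSpan-member b i = δ , λ j →
  sym (trans (lincomb-single b δ-off j) (trans (cong (ℤ._* b i j) δ-on) (ℤP.*-identityˡ (b i j))))
  where
  δ : Fin _ → ℤ
  δ l with l FinP.≟ i
  ... | yes _ = + 1
  ... | no  _ = + 0
  δ-on : δ i ≡ + 1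
  δ-on with i FinP.≟ i
  ... | yes _   = refl
  ... | no  i≢i = ⊥-elim (i≢i refl)
  δ-off : ∀ l → l ≢ i → δ l ≡ + 0
  δ-off l l≢i with l FinP.≟ i
  ... | yes l≡i = ⊥-elim (l≢i l≡i)
  ... | no  _   = refl

-- Iterates of a cyclic permutation

module _ {N} (τ : Permutation′ N) where

  iter-+ : ∀ a b i → iter τ (a + b) i ≡ iter τ a (iter τ b i)
  iter-+ zero    b i = refl
  iter-+ (suc a) b i = cong (τ ⟨$⟩ʳ_) (iter-+ a b i)

  iter-suc : ∀ k i → iter τ (suc k) i ≡ iter τ k (τ ⟨$⟩ʳ i)
  iter-suc k i = trans (cong (λ m → iter τ m i) (ℕP.+-comm 1 k)) (iter-+ k 1 i)

  iter-injective : ∀ k {i j} → iter τ k i ≡ iter τ k j → i ≡ j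
  iter-injective zero    eq = eq
  iter-injective (suc k) eq =
    iter-injective k (trans (sym (inverseˡ τ)) (trans (cong (τ ⟨$⟩ˡ_) eq) (inverseˡ τ)))

  iter-cancel : ∀ a d {i} → iter τ (d + a) i ≡ iter τ a i → iter τ d i ≡ i
  iter-cancel a d {i} eq = iter-injective a (begin
    iter τ a (iter τ d i)  ≡⟨ iter-+ a d i ⟨
    iter τ (a + d) i       ≡⟨ cong (λ m → iter τ m i) (ℕP.+-comm a d) ⟩
    iter τ (d + a) i       ≡⟨ eq ⟩
    iter τ a i             ∎)
    where open ≡-Reasoning

  iter-return : ∀ {a b i} → a ℕ.< b → iter τ a i ≡ iter τ b i →
                ∃ λ d → (suc d + a ≡ b) × (iter τ (suc d) i ≡ i)
  iter-return {a} {b} {i} a<b eq =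
    d , sym b≡ , iter-cancel a (suc d) (trans (cong (λ m → iter τ m i) (sym b≡)) (sym eq))
    where
    d = b ∸ suc a
    b≡ : b ≡ suc d + a
    b≡ = sym (trans (sym (ℕP.+-suc d a)) (ℕP.m∸n+n≡m a<b))

  iter-*-periodic : ∀ {p i} → iter τ p i ≡ i → ∀ m → iter τ (m * p) i ≡ i
  iter-*-periodic         iᵖ≡i zero    = refl
  iter-*-periodic {p} {i} iᵖ≡i (suc m) =
    trans (iter-+ p (m * p) i) (trans (cong (iter τ p) (iter-*-periodic iᵖ≡i m)) iᵖ≡i)

  iter-%-periodic : ∀ {d i} → iter τ (suc d) i ≡ i → ∀ k → iter τ k i ≡ iter τ (k % suc d) i
  iter-%-periodic {d} {i} periodic k = begin
    iter τ k i
      ≡⟨ cong (λ m → iter τ m i) (m≡m%n+[m/n]*n k (suc d)) ⟩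
    iter τ (k % suc d + (k / suc d) * suc d) i
      ≡⟨ iter-+ (k % suc d) _ i ⟩
    iter τ (k % suc d) (iter τ ((k / suc d) * suc d) i)
      ≡⟨ cong (iter τ (k % suc d)) (iter-*-periodic periodic (k / suc d)) ⟩
    iter τ (k % suc d) i
      ∎
    where open ≡-Reasoning

  normℕ-∘iter : ∀ k (v : Vecℤ N) → normℕ (v ∘ iter τ k) ≡ normℕ v
  normℕ-∘iter zero    v = refl
  normℕ-∘iter (suc k) v = trans (normℕ-∘iter k (act τ v)) (normℕ-act τ v)

module NCycle {N} (τ : Permutation′ N) (cycle : IsNCycle τ) where

  period-≥ : ∀ {d i} → iter τ (suc d) i ≡ i → N ≤ suc d
  period-≥ {d} {i} periodic = FinP.injective⇒≤ {f = index} index-injective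
    where
    steps : Fin N → ℕ
    steps j = proj₁ (cycle i j)
    index : Fin N → Fin (suc d)
    index j = Fin.fromℕ< (m%n<n (steps j) (suc d))
    iter-index : ∀ j → iter τ (toℕ (index j)) i ≡ j
    iter-index j = begin
      iter τ (toℕ (index j)) i    ≡⟨ cong (λ m → iter τ m i) (FinP.toℕ-fromℕ< (m%n<n (steps j) (suc d))) ⟩
      iter τ (steps j % suc d) i  ≡⟨ iter-%-periodic τ periodic (steps j) ⟨
      iter τ (steps j) i          ≡⟨ proj₂ (cycle i j) ⟩
      j                           ∎
      where open ≡-Reasoning
    index-injective : ∀ {j j′} → index j ≡ index j′ → j ≡ j′
    index-injective {j} {j′} eq =
      trans (sym (iter-index j)) (trans (cong (λ l → iter τ (toℕ l) i) eq) (iter-index j′))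

  iter-≢-< : ∀ {a b} i → a ℕ.< b → b ℕ.< N → iter τ a i ≢ iter τ b i
  iter-≢-< {a} i a<b b<N eq with iter-return τ a<b eq
  ... | d , refl , periodic = ℕP.<⇒≱ b<N (≤-trans (period-≥ periodic) (ℕP.m≤m+n (suc d) a))

  iter-injective-< : ∀ {a b} i → a ℕ.< N → b ℕ.< N → iter τ a i ≡ iter τ b i → a ≡ b
  iter-injective-< {a} {b} i a<N b<N eq with ℕP.<-cmp a b
  ... | tri< a<b _ _ = ⊥-elim (iter-≢-< i a<b b<N eq)
  ... | tri≈ _ a≡b _ = a≡b
  ... | tri> _ _ b<a = ⊥-elim (iter-≢-< i b<a a<N (sym eq))

  iter-N : ∀ i → iter τ N i ≡ i
  iter-N i with FinP.pigeonhole (ℕP.n<1+n N) (λ k → iter τ (toℕ k) i)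
  ... | a , b , a<b , eq with iter-return τ a<b eq
  ...   | d , b≡ , periodic =
    subst (λ m → iter τ m i ≡ i) (ℕP.≤-antisym d<N (period-≥ periodic)) periodic
    where
    d<N : suc d ≤ N
    d<N = ≤-trans (ℕP.m≤m+n (suc d) (toℕ a)) (≤-trans (≤-reflexive b≡) (FinP.toℕ≤pred[n] b))

-- The rotation

-- 0 ↦ n and suc i ↦ i, so that act (rotation n) agrees with rot.
rotation : ∀ n → Permutation′ (suc n)
rotation n = insert zero (fromℕ n) id

punchIn-fromℕ : ∀ {n} (i : Fin n) → Fin.punchIn (fromℕ n) i ≡ inject₁ i
punchIn-fromℕ zero    = refl
punchIn-fromℕ (suc i) = cong suc (punchIn-fromℕ i)

rot≗act-rotation : ∀ {n} (x : Vecℤ (suc n)) j → rot x j ≡ act (rotation n) x j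
rot≗act-rotation x zero    = refl
rot≗act-rotation x (suc j) = cong x (sym (punchIn-fromℕ j))

toℕ-iter-rotation : ∀ {n} k (i : Fin (suc n)) → k ≤ toℕ i → toℕ (iter (rotation n) k i) ≡ toℕ i ∸ k
toℕ-iter-rotation zero    i k≤i = refl
toℕ-iter-rotation {n} (suc k) i k<i = toℕ-rotation (iter (rotation n) k i) (begin
  toℕ (iter (rotation n) k i)  ≡⟨ toℕ-iter-rotation k i (ℕP.<⇒≤ k<i) ⟩
  toℕ i ∸ k                    ≡⟨ ℕP.+-∸-assoc 1 k<i ⟩
  suc (toℕ i ∸ suc k)          ∎)
  where
  open ≡-Reasoning
  toℕ-rotation : ∀ y {m} → toℕ y ≡ suc m → toℕ (rotation n ⟨$⟩ʳ y) ≡ m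
  toℕ-rotation (suc y) eq =
    trans (cong toℕ (punchIn-fromℕ y)) (trans (FinP.toℕ-inject₁ y) (ℕP.suc-injective eq))

rotation-isNCycle : ∀ n → IsNCycle (rotation n)
rotation-isNCycle n i j = suc (n ∸ toℕ j) + toℕ i , (begin
  iter ρ (suc (n ∸ toℕ j) + toℕ i) i           ≡⟨ iter-+ ρ (suc (n ∸ toℕ j)) (toℕ i) i ⟩
  iter ρ (suc (n ∸ toℕ j)) (iter ρ (toℕ i) i)  ≡⟨ cong (iter ρ (suc (n ∸ toℕ j))) to-zero ⟩
  iter ρ (suc (n ∸ toℕ j)) zero                ≡⟨ iter-suc ρ (n ∸ toℕ j) zero ⟩
  iter ρ (n ∸ toℕ j) (fromℕ n)                 ≡⟨ FinP.toℕ-injective from-last ⟩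
  j                                            ∎)
  where
  open ≡-Reasoning
  ρ = rotation n
  to-zero : iter ρ (toℕ i) i ≡ zero
  to-zero = FinP.toℕ-injective (trans (toℕ-iter-rotation (toℕ i) i ≤-refl) (ℕP.n∸n≡0 (toℕ i)))
  steps≤ : n ∸ toℕ j ≤ toℕ (fromℕ n)
  steps≤ = subst (n ∸ toℕ j ≤_) (sym (FinP.toℕ-fromℕ n)) (ℕP.m∸n≤m n (toℕ j))
  from-last : toℕ (iter ρ (n ∸ toℕ j) (fromℕ n)) ≡ toℕ j
  from-last = begin
    toℕ (iter ρ (n ∸ toℕ j) (fromℕ n))  ≡⟨ toℕ-iter-rotation (n ∸ toℕ j) (fromℕ n) steps≤ ⟩
    toℕ (fromℕ n) ∸ (n ∸ toℕ j)         ≡⟨ cong (_∸ (n ∸ toℕ j)) (FinP.toℕ-fromℕ n) ⟩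
    n ∸ (n ∸ toℕ j)                     ≡⟨ ℕP.m∸[m∸n]≡n (FinP.toℕ≤pred[n] j) ⟩
    toℕ j                               ∎

-- Rational bounds

ℕ→ℚ≡mkℚ : ∀ a → ℕ→ℚ a ≡ mkℚ (+ a) 0 (Coprime.sym (Coprime.1-coprimeTo a))
ℕ→ℚ≡mkℚ a = ℚP.↥p/↧p≡p (mkℚ (+ a) 0 (Coprime.sym (Coprime.1-coprimeTo a)))

ℕ→ℚ-mono-≤ : ∀ {a b} → a ≤ b → ℕ→ℚ a ℚ.≤ ℕ→ℚ b
ℕ→ℚ-mono-≤ {a} {b} a≤b rewrite ℕ→ℚ≡mkℚ a | ℕ→ℚ≡mkℚ b =
  ℚ.*≤* (subst₂ ℤ._≤_ (sym (ℤP.*-identityʳ (+ a))) (sym (ℤP.*-identityʳ (+ b))) (ℤ.+≤+ a≤b))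

ℕ→ℚ-homo-* : ∀ a b → ℕ→ℚ a ℚ.* ℕ→ℚ b ≡ ℕ→ℚ (a * b)
ℕ→ℚ-homo-* a b rewrite ℕ→ℚ≡mkℚ a | ℕ→ℚ≡mkℚ b = cong (ℚ._/ 1) (sym (ℤP.pos-* a b))

ℕ→ℚ-homo-^ : ∀ a k → ℕ→ℚ a ^ℚ k ≡ ℕ→ℚ (a ^ k)
ℕ→ℚ-homo-^ a zero    = refl
ℕ→ℚ-homo-^ a (suc k) = trans (cong (ℕ→ℚ a ℚ.*_) (ℕ→ℚ-homo-^ a k)) (ℕ→ℚ-homo-* a (a ^ k))

^ℚ-nonNeg : ∀ {p} k → 0ℚ ℚ.≤ p → 0ℚ ℚ.≤ p ^ℚ k
^ℚ-nonNeg     zero    0≤p = ℚP.<⇒≤ (ℚP.positive⁻¹ 1ℚ)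
^ℚ-nonNeg {p} (suc k) 0≤p = ℚP.nonNegative⁻¹ _
  {{ℚP.nonNeg*nonNeg⇒nonNeg p {{ℚ.nonNegative 0≤p}} (p ^ℚ k) {{ℚ.nonNegative (^ℚ-nonNeg k 0≤p)}}}}

^ℚ-mono-≤ : ∀ {p q} k → 0ℚ ℚ.≤ p → p ℚ.≤ q → p ^ℚ k ℚ.≤ q ^ℚ k
^ℚ-mono-≤         zero    0≤p p≤q = ℚP.≤-refl
^ℚ-mono-≤ {p} {q} (suc k) 0≤p p≤q =
  ℚP.≤-trans (ℚP.*-monoʳ-≤-nonNeg (p ^ℚ k) {{ℚ.nonNegative (^ℚ-nonNeg k 0≤p)}} p≤q)
             (ℚP.*-monoˡ-≤-nonNeg q {{ℚ.nonNegative (ℚP.≤-trans 0≤p p≤q)}} (^ℚ-mono-≤ k 0≤p p≤q))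

square-≤ : ∀ {a R} → 0ℚ ℚ.≤ R → ℕ→ℚ a ℚ.≤ R → ℕ→ℚ (a * a) ℚ.≤ R ℚ.* R
square-≤ {a} {R} 0≤R a≤R = begin
  ℕ→ℚ (a * a)         ≡⟨ ℕ→ℚ-homo-* a a ⟨
  ℕ→ℚ a ℚ.* ℕ→ℚ a     ≤⟨ ℚP.*-monoˡ-≤-nonNeg (ℕ→ℚ a) {{ℚ.nonNegative (ℕ→ℚ-mono-≤ {0} {a} z≤n)}} a≤R ⟩
  ℕ→ℚ a ℚ.* R         ≤⟨ ℚP.*-monoʳ-≤-nonNeg R {{ℚ.nonNegative 0≤R}} a≤R ⟩
  R ℚ.* R             ∎
  where open ℚP.≤-Reasoning

record NatFloor (R : ℚ) : Set where
  field
    ⌊R⌋    : ℕ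
    ⌊R⌋≤R  : ℕ→ℚ ⌊R⌋ ℚ.≤ R
    R≤     : ∀ {m} → ⌊R⌋ ℕ.< m → R ℚ.≤ ℕ→ℚ m
    ≤⌊R⌋   : ∀ {m} → ℕ→ℚ m ℚ.≤ R → m ≤ ⌊R⌋

natFloor : ∀ R → 0ℚ ℚ.≤ R → NatFloor R
natFloor (mkℚ -[1+ _ ] _ _) (ℚ.*≤* ())
natFloor R@(mkℚ (+ a) d _) _ = record { ⌊R⌋ = a / suc d ; ⌊R⌋≤R = ⌊R⌋≤R ; R≤ = R≤ ; ≤⌊R⌋ = ≤⌊R⌋ }
  where
  cross : ∀ x y z w → x * y ≤ z * w → + x ℤ.* + y ℤ.≤ + z ℤ.* + w
  cross x y z w le = subst₂ ℤ._≤_ (ℤP.pos-* x y) (ℤP.pos-* z w) (ℤ.+≤+ le)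
  uncross : ∀ x y z w → + x ℤ.* + y ℤ.≤ + z ℤ.* + w → x * y ≤ z * w
  uncross x y z w le = ℤP.drop‿+≤+ (subst₂ ℤ._≤_ (sym (ℤP.pos-* x y)) (sym (ℤP.pos-* z w)) le)
  ⌊R⌋≤R : ℕ→ℚ (a / suc d) ℚ.≤ R
  ⌊R⌋≤R rewrite ℕ→ℚ≡mkℚ (a / suc d) =
    ℚ.*≤* (cross (a / suc d) (suc d) a 1
      (≤-trans (m/n*n≤m a (suc d)) (≤-reflexive (sym (ℕP.*-identityʳ a)))))
  R≤ : ∀ {m} → a / suc d ℕ.< m → R ℚ.≤ ℕ→ℚ m
  R≤ {m} ⌊R⌋<m rewrite ℕ→ℚ≡mkℚ m = ℚ.*≤* (cross a 1 m (suc d) (begin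
    a * 1                              ≡⟨ ℕP.*-identityʳ a ⟩
    a                                  ≡⟨ m≡m%n+[m/n]*n a (suc d) ⟩
    a % suc d + (a / suc d) * suc d    <⟨ ℕP.+-monoˡ-< _ (m%n<n a (suc d)) ⟩
    suc d + (a / suc d) * suc d        ≤⟨ ℕP.*-monoˡ-≤ (suc d) ⌊R⌋<m ⟩
    m * suc d                          ∎))
    where open ℕP.≤-Reasoning
  ≤⌊R⌋ : ∀ {m} → ℕ→ℚ m ℚ.≤ R → m ≤ a / suc d
  ≤⌊R⌋ {m} m≤R rewrite ℕ→ℚ≡mkℚ m = begin
    m                  ≡⟨ m*n/n≡m m (suc d) ⟨
    m * suc d / suc d  ≤⟨ /-monoˡ-≤ (suc d) (uncross m (suc d) a 1 (ℚP.drop-*≤* m≤R)) ⟩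
    a * 1 / suc d      ≡⟨ cong (_/ suc d) (ℕP.*-identityʳ a) ⟩
    a / suc d          ∎
    where open ℕP.≤-Reasoning

^-distrib-* : ∀ a b k → (a * b) ^ k ≡ a ^ k * b ^ k
^-distrib-* a b zero    = refl
^-distrib-* a b (suc k) = trans (cong (a * b *_) (^-distrib-* a b k)) (interchange a b (a ^ k) (b ^ k))
  where
  interchange : ∀ a b x y → a * b * (x * y) ≡ a * x * (b * y)
  interchange = ℕSolver.solve-∀

power-bound : ∀ {α R} B K N → 0ℚ ℚ.≤ α → 0ℚ ℚ.≤ R → R ℚ.≤ ℕ→ℚ (B * K) → α ℚ.* ℕ→ℚ (B ^ N) ≡ 1ℚ →
              α ℚ.* R ^ℚ N ℚ.≤ ℕ→ℚ (K ^ N)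
power-bound {α} {R} B K N 0≤α 0≤R R≤BK αBᴺ≡1 = begin
  α ℚ.* R ^ℚ N
    ≤⟨ ℚP.*-monoˡ-≤-nonNeg α {{ℚ.nonNegative 0≤α}} (^ℚ-mono-≤ N 0≤R R≤BK) ⟩
  α ℚ.* ℕ→ℚ (B * K) ^ℚ N
    ≡⟨ cong (α ℚ.*_) (trans (ℕ→ℚ-homo-^ (B * K) N) (cong ℕ→ℚ (^-distrib-* B K N))) ⟩
  α ℚ.* ℕ→ℚ (B ^ N * K ^ N)              ≡⟨ cong (α ℚ.*_) (ℕ→ℚ-homo-* (B ^ N) (K ^ N)) ⟨
  α ℚ.* (ℕ→ℚ (B ^ N) ℚ.* ℕ→ℚ (K ^ N))   ≡⟨ ℚP.*-assoc α _ _ ⟨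
  α ℚ.* ℕ→ℚ (B ^ N) ℚ.* ℕ→ℚ (K ^ N)     ≡⟨ cong (ℚ._* ℕ→ℚ (K ^ N)) αBᴺ≡1 ⟩
  1ℚ ℚ.* ℕ→ℚ (K ^ N)                     ≡⟨ ℚP.*-identityˡ _ ⟩
  ℕ→ℚ (K ^ N)                             ∎
  where open ℚP.≤-Reasoning

G≤t⇒∃[K]GK≤t<2GK : ∀ G t .{{_ : ℕ.NonZero G}} → G ≤ t → ∃ λ K′ → G * suc K′ ≤ t × t ℕ.< 2 * G * suc K′
G≤t⇒∃[K]GK≤t<2GK G t G≤t = K′ , GK≤t , t<2GK
  where
  open ℕP.≤-Reasoning
  t/G≢0 : ℕ.NonZero (t / G)
  t/G≢0 = ℕ.>-nonZero (m≥n⇒m/n>0 G≤t)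
  K′ = ℕ.pred (t / G)
  K≡ : suc K′ ≡ t / G
  K≡ = ℕP.suc-pred (t / G) {{t/G≢0}}
  GK≤t : G * suc K′ ≤ t
  GK≤t = begin
    G * suc K′   ≡⟨ cong (G *_) K≡ ⟩
    G * (t / G)  ≡⟨ ℕP.*-comm G (t / G) ⟩
    t / G * G    ≤⟨ m/n*n≤m t G ⟩
    t            ∎
  t<2GK : t ℕ.< 2 * G * suc K′
  t<2GK = begin-strict
    t                      ≡⟨ m≡m%n+[m/n]*n t G ⟩
    t % G + t / G * G      <⟨ ℕP.+-monoˡ-< (t / G * G) (m%n<n t G) ⟩
    G + t / G * G          ≤⟨ ℕP.+-monoˡ-≤ (t / G * G) (ℕP.m≤n*m G (t / G) {{t/G≢0}}) ⟩
    t / G * G + t / G * G  ≡⟨ double G (t / G) ⟩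
    2 * G * (t / G)        ≡⟨ cong (2 * G *_) K≡ ⟨
    2 * G * suc K′         ∎
    where
    double : ∀ G k → k * G + k * G ≡ 2 * G * k
    double = ℕSolver.solve-∀

finToFun-injective : ∀ {K N} {i j : Fin (K ^ N)} →
                     (∀ l → Fin.finToFun {K} {N} i l ≡ Fin.finToFun j l) → i ≡ j
finToFun-injective {K} {N} {i} {j} i≗j = begin
  i                                      ≡⟨ FinP.funToFin-finToFin {N} {K} i ⟨
  Fin.funToFin (Fin.finToFun {K} {N} i)  ≡⟨ funToFin-cong i≗j ⟩
  Fin.funToFin (Fin.finToFun {K} {N} j)  ≡⟨ FinP.funToFin-finToFin {N} {K} j ⟩
  j                                      ∎
  where
  open ≡-Reasoning
  funToFin-cong : ∀ {m} {f g : Fin m → Fin K} → (∀ l → f l ≡ g l) → Fin.funToFin f ≡ Fin.funToFin g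
  funToFin-cong {zero}  f≗g = refl
  funToFin-cong {suc m} f≗g = cong₂ Fin.combine (f≗g zero) (funToFin-cong (f≗g ∘ suc))

AtLeast-mono : ∀ {M} {P Q : Subset M → Set} {k} → (∀ {Γ} → P Γ → Q Γ) → AtLeast P k → AtLeast Q k
AtLeast-mono P⇒Q (L , P-L , distinct) = L , P⇒Q ∘ P-L , distinct

AtLeast-^ : ∀ {K N M} {P : Subset M → Set} (L : (Fin N → Fin K) → Subset M) →
            (∀ u → P (L u)) → (∀ {u u′} → L u ≐ L u′ → ∀ j → u j ≡ u′ j) → AtLeast P (K ^ N)
AtLeast-^ {K} {N} L P-L L-injective =
  L ∘ Fin.finToFun {K} {N} , P-L ∘ Fin.finToFun {K} {N} ,
  λ i j i≢j Li≐Lj → i≢j (finToFun-injective (L-injective Li≐Lj))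

≐-trans : ∀ {N} {A B C : Subset N} → A ≐ B → B ≐ C → A ≐ C
≐-trans A≐B B≐C x = proj₁ (B≐C x) ∘ proj₁ (A≐B x) , proj₂ (A≐B x) ∘ proj₂ (B≐C x)

image-cong : ∀ {N} {f g : Vecℤ N → Vecℤ N} (Γ : Subset N) → (∀ x j → f x j ≡ g x j) →
             image f Γ ≐ image g Γ
image-cong Γ f≗g y = (λ (x , x∈Γ , y≡) → x , x∈Γ , λ j → trans (y≡ j) (f≗g x j))
                   , (λ (x , x∈Γ , y≡) → x , x∈Γ , λ j → trans (y≡ j) (sym (f≗g x j)))

EventualLowerBound-mono : ∀ {N} {C C′ : Subset N → Set} {α} → (∀ {Γ} → C Γ → C′ Γ) →
                          EventualLowerBound C α → EventualLowerBound C′ α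
EventualLowerBound-mono {C = C} {C′} C⇒C′ (R₀ , bound) = R₀ , λ R R₀≤R 0≤R →
  let k , αRᴺ≤k , many = bound R R₀≤R 0≤R
  in k , αRᴺ≤k , AtLeast-mono {P = λ Γ → C Γ × λN≤ Γ R × WR′ Γ} {Q = λ Γ → C′ Γ × λN≤ Γ R × WR′ Γ}
                              (λ (c , λ≤ , wr) → C⇒C′ c , λ≤ , wr) many

-- The lattices

argmax : ∀ {k} (f : Fin (suc k) → ℕ) → ∃ λ i → ∀ j → f j ≤ f i
argmax {zero}  f = zero , λ { zero → ≤-refl }
argmax {suc k} f with argmax (f ∘ suc)
... | i , f≤fi with f zero ℕ.≤? f (suc i)
...   | yes f0≤fi = suc i , λ { zero → f0≤fi ; (suc j) → f≤fi j }
...   | no  f0≰fi = zero  , λ { zero → ≤-refl ; (suc j) → ≤-trans (f≤fi j) (ℕP.<⇒≤ (ℕP.≰⇒> f0≰fi)) }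

+[1+m]≢-+n : ∀ {m e} → + suc m ≢ ℤ.- + e
+[1+m]≢-+n {e = zero}  ()
+[1+m]≢-+n {e = suc _} ()

module Lattices {n} (τ : Permutation′ (suc n)) (cycle : IsNCycle τ) (K′ : ℕ) where

  open NCycle τ cycle

  N K P M A : ℕ
  N = suc n
  K = suc K′
  P = N * K
  M = 8 * P
  A = 7 * P

  Index : Set
  Index = Fin N → Fin K

  entry : Index → Fin N → ℕ
  entry u zero    = M + toℕ (u zero)
  entry u (suc j) = toℕ (u (suc j))

  generator : Index → Vecℤ N
  generator u j = + entry u j

  basis : Index → Fin N → Vecℤ N
  basis u i j = generator u (iter τ (toℕ i) j)

  Γ : Index → Subset N
  Γ u = InSpan (basis u)

  K<M : K ℕ.< M
  K<M = ℕP.+-mono-≤ (s≤s z≤n) (≤-trans (ℕP.m≤n*m K N) (ℕP.m≤n*m P 7))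

  entry-small : ∀ u {y} → y ≢ zero → entry u y ≤ K
  entry-small u {zero}  y≢0 = ⊥-elim (y≢0 refl)
  entry-small u {suc y} y≢0 = ℕP.<⇒≤ (FinP.toℕ<n (u (suc y)))

  entry-large⇒zero : ∀ u {y} → M ≤ entry u y → y ≡ zero
  entry-large⇒zero u {zero}  M≤e = refl
  entry-large⇒zero u {suc y} M≤e = ⊥-elim (ℕP.<⇒≱ K<M (≤-trans M≤e (entry-small u {suc y} λ ())))

  entry-injective : ∀ {u u′} → (∀ j → entry u j ≡ entry u′ j) → ∀ j → u j ≡ u′ j
  entry-injective e≡ zero    = FinP.toℕ-injective (ℕP.+-cancelˡ-≡ M _ _ (e≡ zero))
  entry-injective e≡ (suc j) = FinP.toℕ-injective (e≡ (suc j))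

  position : Fin N → Fin N
  position i = iter τ (N ∸ toℕ i) zero

  iter-position : ∀ i → iter τ (toℕ i) (position i) ≡ zero
  iter-position i = begin
    iter τ (toℕ i) (iter τ (N ∸ toℕ i) zero) ≡⟨ iter-+ τ (toℕ i) (N ∸ toℕ i) zero ⟨
    iter τ (toℕ i + (N ∸ toℕ i)) zero        ≡⟨ cong (λ m → iter τ m zero) (ℕP.m+[n∸m]≡n (FinP.toℕ≤n i)) ⟩
    iter τ N zero                             ≡⟨ iter-N zero ⟩
    zero                                      ∎
    where open ≡-Reasoning

  iter-position-≢ : ∀ {i k} → k ≢ i → iter τ (toℕ k) (position i) ≢ zero
  iter-position-≢ {i} {k} k≢i eq = k≢i (FinP.toℕ-injective
    (iter-injective-< (position i) (FinP.toℕ<n k) (FinP.toℕ<n i) (trans eq (sym (iter-position i)))))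

  position-injective : ∀ {i k} → position i ≡ position k → i ≡ k
  position-injective {i} {k} eq with i FinP.≟ k
  ... | yes i≡k = i≡k
  ... | no  i≢k = ⊥-elim (iter-position-≢ i≢k (trans (cong (iter τ (toℕ i)) (sym eq)) (iter-position i)))

  -- At position i only the i-th translate has its large entry; the other n contribute at most mK each.
  coordinate-bound : ∀ u (c : Fin N → ℤ) {m} i → (∀ k → ∣ c k ∣ ≤ m) → m ≤ ∣ c i ∣ →
                     A * m ≤ ∣ lincomb c (basis u) (position i) ∣
  coordinate-bound u c {m} i ∣c∣≤m m≤∣ci∣ = ℕP.+-cancelʳ-≤ (m * P) (A * m) X (begin
    A * m + m * P           ≡⟨ regroup P m ⟩
    m * M                   ≤⟨ ℕP.*-mono-≤ m≤∣ci∣ (ℕP.m≤m+n M _) ⟩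
    ∣ c i ∣ * entry u zero  ≡⟨ cong (λ y → ∣ c i ∣ * entry u y) (iter-position i) ⟨
    ∣ c i ∣ * entry u (iter τ (toℕ i) (position i))
                            ≡⟨ ∣term∣ i ⟨
    ∣ term i ∣              ≤⟨ dominant-term term i small ⟩
    X + n * (m * K)         ≤⟨ ℕP.+-monoʳ-≤ X (ℕP.m≤n+m (n * (m * K)) (m * K)) ⟩
    X + (m * K + n * (m * K))  ≡⟨ cong (_+_ X) (regroup′ m n K) ⟩
    X + m * P               ∎)
    where
    open ℕP.≤-Reasoning
    X = ∣ lincomb c (basis u) (position i) ∣
    term : Fin N → ℤ
    term k = c k ℤ.* basis u k (position i)
    ∣term∣ : ∀ k → ∣ term k ∣ ≡ ∣ c k ∣ * entry u (iter τ (toℕ k) (position i))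
    ∣term∣ k = ℤP.∣i*j∣≡∣i∣*∣j∣ (c k) (basis u k (position i))
    small : ∀ k → k ≢ i → ∣ term k ∣ ≤ m * K
    small k k≢i =
      ≤-trans (≤-reflexive (∣term∣ k)) (ℕP.*-mono-≤ (∣c∣≤m k) (entry-small u (iter-position-≢ k≢i)))
    regroup : ∀ P m → 7 * P * m + m * P ≡ m * (8 * P)
    regroup = ℕSolver.solve-∀
    regroup′ : ∀ m n K → m * K + n * (m * K) ≡ m * (suc n * K)
    regroup′ = ℕSolver.solve-∀

  D : Index → ℕ
  D u = normℕ (generator u)

  normℕ-basis : ∀ u i → normℕ (basis u i) ≡ D u
  normℕ-basis u i = normℕ-∘iter τ (toℕ i) (generator u)

  D≤[9P]² : ∀ u → D u ≤ (9 * P) * (9 * P)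
  D≤[9P]² u = begin
    D u
      ≤⟨ ℕP.+-mono-≤ (ℕP.*-mono-≤ e₀≤ e₀≤) (sum≤* _ λ j → ℕP.*-mono-≤ (eₛ≤ j) (eₛ≤ j)) ⟩
    (M + K) * (M + K) + n * (K * K)
      ≤⟨ ℕP.m≤m+n _ _ ⟩
    (M + K) * (M + K) + n * (K * K) + (17 * (n * n) + 17 * n) * (K * K)
      ≡⟨ expand n K ⟨
    (9 * P) * (9 * P)
      ∎
    where
    open ℕP.≤-Reasoning
    e₀≤ : entry u zero ≤ M + K
    e₀≤ = ℕP.+-monoʳ-≤ M (ℕP.<⇒≤ (FinP.toℕ<n (u zero)))
    eₛ≤ : ∀ j → entry u (suc j) ≤ K
    eₛ≤ j = entry-small u {suc j} λ ()
    expand : ∀ n K → (9 * (suc n * K)) * (9 * (suc n * K)) ≡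
             (8 * (suc n * K) + K) * (8 * (suc n * K) + K) + n * (K * K)
               + (17 * (n * n) + 17 * n) * (K * K)
    expand = ℕSolver.solve-∀

  D<2A² : ∀ u → D u ℕ.< 2 * (A * A)
  D<2A² u = begin-strict
    D u                            ≤⟨ D≤[9P]² u ⟩
    (9 * P) * (9 * P)              <⟨ ℕP.m<m+n _ (s≤s z≤n) ⟩
    (9 * P) * (9 * P) + 17 * (P * P)  ≡⟨ expand P ⟨
    2 * (A * A)                    ∎
    where
    open ℕP.≤-Reasoning
    expand : ∀ P → 2 * ((7 * P) * (7 * P)) ≡ (9 * P) * (9 * P) + 17 * (P * P)
    expand = ℕSolver.solve-∀

  basis-at-position : ∀ u i → basis u i (position i) ≡ generator u zero
  basis-at-position u i = cong (generator u) (iter-position i)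

  basis-nonzero : ∀ u i → ¬ IsZero (basis u i)
  basis-nonzero u i basis≡0 with trans (sym (basis-at-position u i)) (basis≡0 (position i))
  ... | ()

  data Shape (u : Index) (c : Fin N → ℤ) : Set where
    trivial : (∀ k → c k ≡ + 0) → Shape u c
    long    : 2 * (A * A) ≤ normℕ (lincomb c (basis u)) → Shape u c
    +basis  : ∀ i → (∀ j → lincomb c (basis u) j ≡ basis u i j) → Shape u c
    -basis  : ∀ i → (∀ j → lincomb c (basis u) j ≡ ℤ.- basis u i j) → Shape u c

  single-shape : ∀ u c i → (∀ k → k ≢ i → c k ≡ + 0) → ∣ c i ∣ ≡ 1 → Shape u c
  single-shape u c i others = sign-cases (c i) refl
    where
    x≡ci*bᵢ : ∀ j → lincomb c (basis u) j ≡ c i ℤ.* basis u i j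
    x≡ci*bᵢ = lincomb-single (basis u) others
    sign-cases : ∀ σ → c i ≡ σ → ∣ σ ∣ ≡ 1 → Shape u c
    sign-cases (+ 1)           ci≡ _ = +basis i λ j →
      trans (x≡ci*bᵢ j) (trans (cong (ℤ._* basis u i j) ci≡) (ℤP.*-identityˡ (basis u i j)))
    sign-cases -[1+ 0 ]        ci≡ _ = -basis i λ j →
      trans (x≡ci*bᵢ j) (trans (cong (ℤ._* basis u i j) ci≡) (ℤP.-1*i≡-i (basis u i j)))
    sign-cases (+ 0)           _ ()
    sign-cases (+ suc (suc _)) _ ()
    sign-cases -[1+ suc _ ]    _ ()

  unit-shape : ∀ u c i → (∀ k → ∣ c k ∣ ≤ 1) → ∣ c i ∣ ≡ 1 → Shape u c
  unit-shape u c i ∣c∣≤1 ∣ci∣≡1 with FinP.all? (λ k → (k FinP.≟ i) ⊎-dec (c k ℤ.≟ + 0))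
  ... | yes only-i = single-shape u c i (λ k k≢i → fromInj₂ (⊥-elim ∘ k≢i) (only-i k)) ∣ci∣≡1
  ... | no ¬only-i with FinP.¬∀⟶∃¬ N _ (λ k → (k FinP.≟ i) ⊎-dec (c k ℤ.≟ + 0)) ¬only-i
  ...   | k , k-other = long (2a²≤normℕ′ (lincomb c (basis u))
                                         (k-other ∘ inj₁ ∘ sym ∘ position-injective)
                                         (A≤ i (≤-reflexive (sym ∣ci∣≡1)))
                                         (A≤ k (ℕP.n≢0⇒n>0 (k-other ∘ inj₂ ∘ ℤP.∣i∣≡0⇒i≡0))))
    where
    A≤ : ∀ l → 1 ≤ ∣ c l ∣ → A ≤ ∣ lincomb c (basis u) (position l) ∣
    A≤ l 1≤∣cl∣ = ≤-trans (≤-reflexive (sym (ℕP.*-identityʳ A))) (coordinate-bound u c l ∣c∣≤1 1≤∣cl∣)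

  shape : ∀ u c → Shape u c
  shape u c with argmax (∣_∣ ∘ c)
  ... | i , ∣c∣≤∣ci∣ with ∣ c i ∣ in ∣ci∣≡
  ...   | zero        = trivial λ k → ℤP.∣i∣≡0⇒i≡0 (ℕP.n≤0⇒n≡0 (∣c∣≤∣ci∣ k))
  ...   | suc zero    = unit-shape u c i ∣c∣≤∣ci∣ ∣ci∣≡
  ...   | suc (suc m) = long (2a²≤normℕ (lincomb c (basis u)) {A} (position i)
                                (≤-trans (ℕP.*-monoʳ-≤ A (s≤s (s≤s z≤n)))
                                         (coordinate-bound u c i ∣c∣≤∣ci∣ (≤-reflexive (sym ∣ci∣≡)))))

  D≤normℕ : ∀ u c → ¬ IsZero (lincomb c (basis u)) → D u ≤ normℕ (lincomb c (basis u))
  D≤normℕ u c x≢0 with shape u c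
  ... | trivial c≡0 = ⊥-elim (x≢0 (lincomb-zero (basis u) c≡0))
  ... | long 2A²≤x  = ≤-trans (ℕP.<⇒≤ (D<2A² u)) 2A²≤x
  ... | +basis i x≡ = ≤-reflexive (sym (trans (normℕ-cong x≡) (normℕ-basis u i)))
  ... | -basis i x≡ =
    ≤-reflexive (sym (trans (normℕ-cong x≡) (trans (normℕ-neg (basis u i)) (normℕ-basis u i))))

  basis-independent : ∀ u → LinIndep (basis u)
  basis-independent u c x≡0 with shape u c
  ... | trivial c≡0 = c≡0
  ... | long 2A²≤x  =
    ⊥-elim (ℕP.<⇒≱ (ℕP.≤-<-trans z≤n (D<2A² u)) (≤-trans 2A²≤x (≤-reflexive (normℕ-zero x≡0))))
  ... | +basis i x≡ = ⊥-elim (basis-nonzero u i λ j → trans (sym (x≡ j)) (x≡0 j))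
  ... | -basis i x≡ = ⊥-elim (basis-nonzero u i λ j → ℤP.neg-injective (trans (sym (x≡ j)) (x≡0 j)))

  iter-rotation : ∀ i j → iter τ (toℕ (rotation n ⟨$⟩ʳ i)) (τ ⟨$⟩ʳ j) ≡ iter τ (toℕ i) j
  iter-rotation zero    j = begin
    iter τ (toℕ (fromℕ n)) (τ ⟨$⟩ʳ j) ≡⟨ cong (λ m → iter τ m (τ ⟨$⟩ʳ j)) (FinP.toℕ-fromℕ n) ⟩
    iter τ n (τ ⟨$⟩ʳ j)               ≡⟨ iter-suc τ n j ⟨
    iter τ N j                        ≡⟨ iter-N j ⟩
    j                                 ∎
    where open ≡-Reasoning
  iter-rotation (suc i) j = begin
    iter τ (toℕ (Fin.punchIn (fromℕ n) i)) (τ ⟨$⟩ʳ j)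
      ≡⟨ cong (λ l → iter τ (toℕ l) (τ ⟨$⟩ʳ j)) (punchIn-fromℕ i) ⟩
    iter τ (toℕ (inject₁ i)) (τ ⟨$⟩ʳ j)
      ≡⟨ cong (λ m → iter τ m (τ ⟨$⟩ʳ j)) (FinP.toℕ-inject₁ i) ⟩
    iter τ (toℕ i) (τ ⟨$⟩ʳ j)
      ≡⟨ iter-suc τ (toℕ i) j ⟨
    iter τ (suc (toℕ i)) j
      ∎
    where open ≡-Reasoning

  lincomb-shift : ∀ u c j → lincomb c (basis u ∘ (rotation n ⟨$⟩ʳ_)) (τ ⟨$⟩ʳ j) ≡ lincomb c (basis u) j
  lincomb-shift u c j = Σᶠ-cong λ i → cong (λ y → c i ℤ.* generator u y) (iter-rotation i j)

  Γ-invariant : ∀ u → image (act τ) (Γ u) ≐ Γ u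
  Γ-invariant u y = to , from
    where
    ρ = rotation n
    to : image (act τ) (Γ u) y → Γ u y
    to (x , (c , x≡) , y≡) = c ∘ (ρ ⟨$⟩ʳ_) , λ j → begin
      y j                                                        ≡⟨ y≡ j ⟩
      x (τ ⟨$⟩ʳ j)                                               ≡⟨ x≡ (τ ⟨$⟩ʳ j) ⟩
      lincomb c (basis u) (τ ⟨$⟩ʳ j)                             ≡⟨ lincomb-permute ρ c (basis u) _ ⟩
      lincomb (c ∘ (ρ ⟨$⟩ʳ_)) (basis u ∘ (ρ ⟨$⟩ʳ_)) (τ ⟨$⟩ʳ j)  ≡⟨ lincomb-shift u (c ∘ (ρ ⟨$⟩ʳ_)) j ⟩
      lincomb (c ∘ (ρ ⟨$⟩ʳ_)) (basis u) j                        ∎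
      where open ≡-Reasoning
    from : Γ u y → image (act τ) (Γ u) y
    from (c , y≡) = lincomb c (basis u ∘ (ρ ⟨$⟩ʳ_)) ,
                    InSpan-lincomb {b = basis u} c (λ i → InSpan-member (basis u) (ρ ⟨$⟩ʳ i)) ,
                    λ j → trans (y≡ j) (sym (lincomb-shift u c j))

  basis-minimal : ∀ u i → InS (Γ u) (basis u i)
  basis-minimal u i = InSpan-member (basis u) i , basis-nonzero u i , minimal
    where
    minimal : ∀ w → Γ u w → ¬ IsZero w → ‖ basis u i ‖² ℤ.≤ ‖ w ‖²
    minimal w (c , w≡) w≢0 = subst₂ ℤ._≤_ (sym (‖‖²≡normℕ (basis u i))) (sym (‖‖²≡normℕ w)) (ℤ.+≤+ (begin
      normℕ (basis u i)            ≡⟨ normℕ-basis u i ⟩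
      D u                          ≤⟨ D≤normℕ u c (λ x≡0 → w≢0 λ j → trans (w≡ j) (x≡0 j)) ⟩
      normℕ (lincomb c (basis u))  ≡⟨ normℕ-cong w≡ ⟨
      normℕ w                      ∎))
      where open ℕP.≤-Reasoning

  Γ-WR′ : ∀ u → WR′ (Γ u)
  Γ-WR′ u x = (λ x∈Γ → N , basis u , basis-minimal u , x∈Γ)
            , λ (k , vs , vs∈S , d , x≡) →
                InSpan-resp {b = basis u} (sym ∘ x≡) (InSpan-lincomb {b = basis u} d (proj₁ ∘ vs∈S))

  generator∈Γ⇒≡ : ∀ {u u′} c → (∀ j → generator u j ≡ lincomb c (basis u′) j) → ∀ j → u j ≡ u′ j
  generator∈Γ⇒≡ {u} {u′} c gen≡ with shape u′ c
  ... | trivial c≡0 = ⊥-elim (+[1+m]≢-+n {e = 0} (trans (gen≡ zero) (lincomb-zero (basis u′) c≡0 zero)))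
  ... | long 2A²≤x  = ⊥-elim (ℕP.<⇒≱ (D<2A² u) (≤-trans 2A²≤x (≤-reflexive (sym (normℕ-cong gen≡)))))
  ... | -basis i x≡ = ⊥-elim (+[1+m]≢-+n (trans (gen≡ zero) (x≡ zero)))
  ... | +basis i x≡ = entry-injective λ j → ℤP.+-injective (begin
    generator u j                    ≡⟨ trans (gen≡ j) (x≡ j) ⟩
    generator u′ (iter τ (toℕ i) j)  ≡⟨ cong (λ m → generator u′ (iter τ m j)) i≡0 ⟩
    generator u′ j                   ∎)
    where
    open ≡-Reasoning
    iᶻ≡0 : iter τ (toℕ i) zero ≡ zero
    iᶻ≡0 = entry-large⇒zero u′
      (≤-trans (ℕP.m≤m+n M _) (≤-reflexive (ℤP.+-injective (trans (gen≡ zero) (x≡ zero)))))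
    i≡0 : toℕ i ≡ 0
    i≡0 = iter-injective-< zero (FinP.toℕ<n i) (s≤s z≤n) iᶻ≡0

  Γ-injective : ∀ {u u′} → Γ u ≐ Γ u′ → ∀ j → u j ≡ u′ j
  Γ-injective {u} Γ≐ =
    let c , gen≡ = proj₁ (Γ≐ (generator u)) (InSpan-member (basis u) zero) in generator∈Γ⇒≡ c gen≡

  Γ-InC : ∀ u → InC τ (Γ u)
  Γ-InC u = (basis u , basis-independent u , λ _ → (λ x∈Γ → x∈Γ) , (λ x∈Γ → x∈Γ)) , Γ-invariant u

  Γ-λN≤ : ∀ u {R} → 0ℚ ℚ.≤ R → ℕ→ℚ (9 * P) ℚ.≤ R → λN≤ (Γ u) R
  Γ-λN≤ u {R} 0≤R 9P≤R = basis u , basis-independent u , InSpan-member (basis u) , λ i → begin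
    ℤ→ℚ ‖ basis u i ‖²         ≡⟨ cong ℤ→ℚ (trans (‖‖²≡normℕ (basis u i)) (cong +_ (normℕ-basis u i))) ⟩
    ℕ→ℚ (D u)                  ≤⟨ ℕ→ℚ-mono-≤ (D≤[9P]² u) ⟩
    ℕ→ℚ (9 * P * (9 * P))      ≤⟨ square-≤ {9 * P} 0≤R 9P≤R ⟩
    R ℚ.* R                    ∎
    where open ℚP.≤-Reasoning

scale : ℕ → ℕ
scale n = 2 * (9 * suc n)

-- (18N)ᴺ as a literal successor, so that its reciprocal needs no separate NonZero proof.
scaleᴺ : ℕ → ℚ
scaleᴺ n = mkℚ (+ suc (ℕ.pred (scale n ^ suc n))) 0 (Coprime.sym (Coprime.1-coprimeTo _))

α[_] : ℕ → ℚ
α[ n ] = ℚ.1/ scaleᴺ n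

α-positive : ∀ n → 0ℚ < α[ n ]
α-positive n = ℚP.positive⁻¹ α[ n ]

α*scaleᴺ≡1 : ∀ n → α[ n ] ℚ.* ℕ→ℚ (scale n ^ suc n) ≡ 1ℚ
α*scaleᴺ≡1 n = begin
  α[ n ] ℚ.* ℕ→ℚ (scale n ^ suc n)
    ≡⟨ cong (λ m → α[ n ] ℚ.* ℕ→ℚ m) (ℕP.suc-pred _ {{ℕP.m^n≢0 (scale n) (suc n)}}) ⟨
  α[ n ] ℚ.* ℕ→ℚ (suc (ℕ.pred (scale n ^ suc n)))
    ≡⟨ cong (α[ n ] ℚ.*_) (ℕ→ℚ≡mkℚ (suc (ℕ.pred (scale n ^ suc n)))) ⟩
  α[ n ] ℚ.* scaleᴺ n
    ≡⟨ ℚP.*-inverseˡ (scaleᴺ n) ⟩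
  1ℚ
    ∎
  where open ≡-Reasoning

lattice-count : ∀ {n} (τ : Permutation′ (suc n)) → IsNCycle τ → ∀ K′ {R} → 0ℚ ℚ.≤ R →
                ℕ→ℚ (9 * suc n * suc K′) ℚ.≤ R → R ℚ.≤ ℕ→ℚ (scale n * suc K′) →
                ∃ λ k → (α[ n ] ℚ.* R ^ℚ suc n ℚ.≤ ℕ→ℚ k) × AtLeast (λ Γ → InC τ Γ × λN≤ Γ R × WR′ Γ) k
lattice-count {n} τ cycle K′ {R} 0≤R 9NK≤R R≤scale*K =
  suc K′ ^ N ,
  power-bound (scale n) (suc K′) N (ℚP.<⇒≤ (α-positive n)) 0≤R R≤scale*K (α*scaleᴺ≡1 n) ,
  AtLeast-^ {P = λ Γ → InC τ Γ × λN≤ Γ R × WR′ Γ} Γ (λ u → Γ-InC u , Γ-λN≤ u 0≤R 9P≤R , Γ-WR′ u) Γ-injective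
  where
  open Lattices τ cycle K′
  9P≤R : ℕ→ℚ (9 * P) ℚ.≤ R
  9P≤R = subst (λ m → ℕ→ℚ m ℚ.≤ R) (ℕP.*-assoc 9 N K) 9NK≤R

n-cycle-lower-bound : ∀ {n} (τ : Permutation′ (suc n)) → IsNCycle τ → EventualLowerBound (InC τ) α[ n ]
n-cycle-lower-bound {n} τ cycle = ℕ→ℚ (9 * suc n) , λ R 9N≤R 0≤R →
  let open NatFloor (natFloor R 0≤R)
      K′ , 9NK≤⌊R⌋ , ⌊R⌋<scale*K = G≤t⇒∃[K]GK≤t<2GK (9 * suc n) ⌊R⌋ (≤⌊R⌋ 9N≤R)
  in lattice-count τ cycle K′ 0≤R (ℚP.≤-trans (ℕ→ℚ-mono-≤ 9NK≤⌊R⌋) ⌊R⌋≤R) (R≤ ⌊R⌋<scale*K)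

rot-lower-bound : ∀ n → EventualLowerBound {suc n} (λ Γ → FullRankSublattice Γ × (image rot Γ ≐ Γ)) α[ n ]
rot-lower-bound n = EventualLowerBound-mono {C = InC (rotation n)} {α = α[ n ]}
  (λ {Γ} (full , invariant) → full , ≐-trans (image-cong Γ rot≗act-rotation) invariant)
  (n-cycle-lower-bound (rotation n) (rotation-isNCycle n))

-- The construction also works for N = 1.
corollary1p5 : ∀ (n : ℕ) → 2 ≤ suc n →
    ∃ λ (α : ℚ) → (0ℚ < α) ×
      ((∀ (τ : Permutation′ (suc n)) → IsNCycle τ → EventualLowerBound (InC τ) α) ×
       EventualLowerBound {suc n} (λ Γ → FullRankSublattice Γ × (image rot Γ ≐ Γ)) α)
corollary1p5 n _ = α[ n ] , α-positive n , n-cycle-lower-bound , rot-lower-bound n
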